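{- Let $n \geq 3$ and let $\mathrm{k}$ be a field of characteristic zero. The pre-WDVV ring $R_n$ is (isomorphic to) the Stanley-Reisner ring $\mathrm{k}[\Delta_n]$ of the Whitehouse complex $\Delta_n$, via the identification of the variable $x_\sigma$, $\sigma = S/\overline{S}$, with the vertex $S$ of $\Delta_n$, where $S$ is the block of $\sigma$ not containing $1$.
   Context: A stable $2$-partition of $\{1,\ldots,n\}$ is an unordered partition $\sigma = S_1/S_2$ of $\{1,\ldots,n\}$ into two blocks with $|S_1|,|S_2| \geq 2$; $P_n$ denotes the set of these. For $\sigma = S_1/S_2$ and $\tau = T_1/T_2$ in $P_n$, $a(\sigma,\tau)$ is the number of nonempty pairwise distinct sets among $S_i \cap T_j$, $1 \le i,j \le 2$. The pre-WDVV ring is $R_n = \mathrm{k}[x_\sigma : \sigma \in P_n]/J_n$, where $J_n$ is the ideal generated by all products $x_\sigma x_\tau$ with $a(\sigma,\tau)=4$. The Whitehouse complex $\Delta_n$ is the simplicial complex with vertex set $V_n = \{S \subseteq \{2,\ldots,n\} : 2 \le |S| \le n-2\}$, in which a subset $F \subseteq V_n$ is a face iff for all $S,T \in F$ one has $S \subseteq T$, $T \subseteq S$, or $S \cap T = \emptyset$. The Stanley-Reisner ring of a simplicial complex $\Delta$ on vertex set $V$ is $\mathrm{k}[x_v : v \in V]/I(\Delta)$ where $I(\Delta)$ is generated by the monomials $\prod_{v\in N} x_v$ for non-faces $N$. -}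

module Defs where

open import Level using (Level; _⊔_) renaming (suc to lsuc)
open import Data.Nat using (ℕ; zero; suc; _≤_; _∸_; s≤s; z≤n)
open import Data.Nat.Properties using (∸-monoʳ-≤; m+n∸n≡m; ≤-trans; ≤-reflexive)
open import Data.Fin.Subset.Properties using (∣∁p∣≡n∸∣p∣)
open import Data.Bool using (Bool; true; false)
import Data.Bool as B
open import Data.Vec using (Vec; []; _∷_)
open import Data.Vec.Properties using (≡-dec)
open import Data.Fin.Subset using (Subset; ∁; _∩_; _⊆_; ∣_∣; ⊥)
open import Data.List using (List; []; _∷_; length; filter; deduplicate; foldr)
open import Data.List.Membership.Propositional using (_∈_)
open import Data.List.Relation.Unary.AllPairs using (AllPairs)
open import Data.Product using (Σ; _×_; _,_; proj₁; proj₂)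
open import Data.Sum using (_⊎_)
open import Relation.Binary using (Setoid; Rel)
open import Relation.Binary.PropositionalEquality using (_≡_; _≢_; subst; sym; refl)
open import Relation.Nullary using (¬_; ¬?)
open import Relation.Nullary.Decidable using (Dec)
open import Algebra.Bundles using (CommutativeRing)
open import Function using (_⇔_)

module _ {c ℓ : Level} (K : CommutativeRing c ℓ) where
  open CommutativeRing K

  natCast : ℕ → Carrier
  natCast zero    = 0#
  natCast (suc n) = 1# + natCast n

  IsField : Set (c ⊔ ℓ)
  IsField = (¬ (1# ≈ 0#)) ×
            ((x : Carrier) → ¬ (x ≈ 0#) → Σ Carrier λ y → (x * y) ≈ 1#)

  CharZero : Set ℓ
  CharZero = (m : ℕ) → ¬ (natCast (suc m) ≈ 0#)

-- This is the free commutative K-algebra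
-- on X, i.e. the polynomial ring.

module Poly {c ℓ x e : Level} (K : CommutativeRing c ℓ) (X : Setoid x e) where
  open CommutativeRing K using (0#; 1#) renaming
    (Carrier to k; _+_ to _+k_; _*_ to _*k_; _≈_ to _≈k_)
  open Setoid X renaming (Carrier to V; _≈_ to _≈v_)

  infixl 6 _⊕_
  infixl 7 _⊗_

  data Pol : Set (c ⊔ x) where
    con : k → Pol
    var : V → Pol
    _⊕_ : Pol → Pol → Pol
    _⊗_ : Pol → Pol → Pol
    ⊝_  : Pol → Pol

  infix 4 _~_
  data _~_ : Pol → Pol → Set (c ⊔ ℓ ⊔ x ⊔ e) where
    ~refl  : ∀ {p} → p ~ p
    ~sym   : ∀ {p q} → p ~ q → q ~ p
    ~trans : ∀ {p q r} → p ~ q → q ~ r → p ~ r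
    ⊕-cong : ∀ {p p' q q'} → p ~ p' → q ~ q' → p ⊕ q ~ p' ⊕ q'
    ⊗-cong : ∀ {p p' q q'} → p ~ p' → q ~ q' → p ⊗ q ~ p' ⊗ q'
    ⊝-cong : ∀ {p q} → p ~ q → ⊝ p ~ ⊝ q
    ⊕-assoc : ∀ p q r → (p ⊕ q) ⊕ r ~ p ⊕ (q ⊕ r)
    ⊕-comm  : ∀ p q → p ⊕ q ~ q ⊕ p
    ⊕-idˡ   : ∀ p → con 0# ⊕ p ~ p
    ⊝-invˡ  : ∀ p → (⊝ p) ⊕ p ~ con 0#
    ⊗-assoc : ∀ p q r → (p ⊗ q) ⊗ r ~ p ⊗ (q ⊗ r)
    ⊗-comm  : ∀ p q → p ⊗ q ~ q ⊗ p
    ⊗-idˡ   : ∀ p → con 1# ⊗ p ~ p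
    distribʳ : ∀ p q r → (q ⊕ r) ⊗ p ~ (q ⊗ p) ⊕ (r ⊗ p)
    con-cong : ∀ {a b} → a ≈k b → con a ~ con b
    con-+   : ∀ a b → con (a +k b) ~ con a ⊕ con b
    con-*   : ∀ a b → con (a *k b) ~ con a ⊗ con b
    var-cong : ∀ {u v} → u ≈v v → var u ~ var v

  data InIdeal {g : Level} (G : Pol → Set g) : Pol → Set (c ⊔ ℓ ⊔ x ⊔ e ⊔ g) where
    gen  : ∀ {p} → G p → InIdeal G p
    zero : InIdeal G (con 0#)
    add  : ∀ {p q} → InIdeal G p → InIdeal G q → InIdeal G (p ⊕ q)
    mul  : ∀ r {p} → InIdeal G p → InIdeal G (r ⊗ p)
    resp : ∀ {p q} → p ~ q → InIdeal G p → InIdeal G q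

  _≡[mod_]_ : {g : Level} → Pol → (Pol → Set g) → Pol → Set (c ⊔ ℓ ⊔ x ⊔ e ⊔ g)
  p ≡[mod G ] q = InIdeal G (p ⊕ (⊝ q))

  prodVars : List V → Pol
  prodVars = foldr (λ v p → var v ⊗ p) (con 1#)

module _ {c ℓ x e y f : Level} (K : CommutativeRing c ℓ)
         (X : Setoid x e) (Y : Setoid y f) where
  private
    module PX = Poly K X
    module PY = Poly K Y

  subst-vars : (Setoid.Carrier X → Setoid.Carrier Y) → PX.Pol → PY.Pol
  subst-vars h (PX.con a) = PY.con a
  subst-vars h (PX.var v) = PY.var (h v)
  subst-vars h (p PX.⊕ q) = subst-vars h p PY.⊕ subst-vars h q
  subst-vars h (p PX.⊗ q) = subst-vars h p PY.⊗ subst-vars h q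
  subst-vars h (PX.⊝ p)   = PY.⊝ subst-vars h p

-- Combinatorics.  The ground set {1,…,n} is Fin n, the element 1 being
-- the index zero (the head of a Subset n = Vec Bool n).

has1 : ∀ {n} → Subset n → Bool
has1 []      = false
has1 (b ∷ _) = b

_≟S_ : ∀ {n} → (S T : Subset n) → Dec (S ≡ T)
_≟S_ = ≡-dec B._≟_

-- Stable 2-partitions S₁/S₂ : represented by S₁, with S₂ = ∁ S₁
-- (so S₁ ∩ S₂ = ∅ and S₁ ∪ S₂ = {1..n}); both blocks of size ≥ 2.
PRep : ℕ → Set
PRep n = Σ (Subset n) λ S → (2 ≤ ∣ S ∣) × (2 ≤ ∣ ∁ S ∣)

block₁ block₂ : ∀ {n} → PRep n → Subset n
block₁ σ = proj₁ σ
block₂ σ = ∁ (proj₁ σ)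

-- the partition is unordered: S/∁S is the same as ∁S/S
_≈P_ : ∀ {n} → PRep n → PRep n → Set
σ ≈P τ = (block₁ σ ≡ block₁ τ) ⊎ (block₁ σ ≡ block₂ τ)

P : ℕ → Setoid Level.zero Level.zero
P n = record
  { Carrier = PRep n
  ; _≈_ = _≈P_ {n}
  ; isEquivalence = record { refl = λ {σ} → refl' {σ} ; sym = λ {σ} {τ} → sym' {σ} {τ} ; trans = λ {σ} {τ} {ρ} → trans' {σ} {τ} {ρ} } }
  where
  open import Data.Sum using (inj₁; inj₂)
  open import Relation.Binary.PropositionalEquality using (trans; cong)
  open import Data.Fin.Subset.Properties using ()
  ∁∁ : ∀ {m} (S : Subset m) → ∁ (∁ S) ≡ S
  ∁∁ [] = refl
  ∁∁ (true ∷ S) = cong (true ∷_) (∁∁ S)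
  ∁∁ (false ∷ S) = cong (false ∷_) (∁∁ S)
  refl' : ∀ {σ : PRep n} → σ ≈P σ
  refl' = inj₁ refl
  sym' : ∀ {σ τ : PRep n} → σ ≈P τ → τ ≈P σ
  sym' (inj₁ e) = inj₁ (sym e)
  sym' {σ} {τ} (inj₂ e) = inj₂ (trans (sym (∁∁ (proj₁ τ))) (cong ∁ (sym e)))
  trans' : ∀ {σ τ ρ : PRep n} → σ ≈P τ → τ ≈P ρ → σ ≈P ρ
  trans' (inj₁ e) (inj₁ e') = inj₁ (trans e e')
  trans' (inj₁ e) (inj₂ e') = inj₂ (trans e e')
  trans' (inj₂ e) (inj₁ e') = inj₂ (trans e (cong ∁ e'))
  trans' {ρ = ρ} (inj₂ e) (inj₂ e') = inj₁ (trans e (trans (cong ∁ e') (∁∁ (proj₁ ρ))))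

a : ∀ {n} → PRep n → PRep n → ℕ
a σ τ = length (deduplicate _≟S_ (filter (λ X → ¬? (X ≟S ⊥)) inters))
  where
  inters = (block₁ σ ∩ block₁ τ) ∷ (block₁ σ ∩ block₂ τ) ∷
           (block₂ σ ∩ block₁ τ) ∷ (block₂ σ ∩ block₂ τ) ∷ []

VRep : ℕ → Set
VRep n = Σ (Subset n) λ S → (has1 S ≡ false) × (2 ≤ ∣ S ∣) × (∣ S ∣ ≤ n ∸ 2)

V : ℕ → Setoid Level.zero Level.zero
V n = record
  { Carrier = VRep n
  ; _≈_ = λ S T → proj₁ S ≡ proj₁ T
  ; isEquivalence = record
      { refl = refl ; sym = sym
      ; trans = Relation.Binary.PropositionalEquality.trans } }

-- faces of Δ_n: finite sets F of vertices (lists of pairwise distinct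
-- vertices) any two members of which are nested or disjoint
IsFace : ∀ {n} → List (VRep n) → Set
IsFace F = ∀ {S T} → S ∈ F → T ∈ F →
  (proj₁ S ⊆ proj₁ T) ⊎ (proj₁ T ⊆ proj₁ S) ⊎ (proj₁ S ∩ proj₁ T ≡ ⊥)

Distinct : ∀ {n} → List (VRep n) → Set
Distinct = AllPairs (λ S T → proj₁ S ≢ proj₁ T)

private
  lem : ∀ n m → 2 ≤ m → m ≤ n ∸ 2 → 2 ≤ n ∸ m
  lem zero m (s≤s (s≤s _)) ()
  lem (suc zero) m (s≤s (s≤s _)) ()
  lem (suc (suc k)) m _ m≤k =
    ≤-trans (≤-reflexive (sym (m+n∸n≡m 2 k))) (∸-monoʳ-≤ (suc (suc k)) m≤k)
  ∣∁∣ : ∀ {n} (S : Subset n) → ∣ ∁ S ∣ ≡ n ∸ ∣ S ∣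
  ∣∁∣ = ∣∁p∣≡n∸∣p∣

vertex↦partition : ∀ {n} → VRep n → PRep n
vertex↦partition {n} (S , _ , two≤ , ≤n-2) =
  S , two≤ , subst (2 ≤_) (sym (∣∁∣ S)) (lem n ∣ S ∣ two≤ ≤n-2)

module Rings {c ℓ : Level} (K : CommutativeRing c ℓ) (n : ℕ) where
  module PP = Poly K (P n)
  module PV = Poly K (V n)

  Jgen : PP.Pol → Set c
  Jgen p = Σ (PRep n) λ σ → Σ (PRep n) λ τ →
             (a σ τ ≡ 4) × (p ≡ PP.var σ PP.⊗ PP.var τ)

  Igen : PV.Pol → Set c
  Igen p = Σ (List (VRep n)) λ N → Distinct N × (¬ IsFace N) ×
             (p ≡ PV.prodVars N)

  ι : PV.Pol → PP.Pol
  ι = subst-vars K (V n) (P n) vertex↦partition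

  -- ι induces an isomorphism k[Δ_n] = k[x_S]/I(Δ_n) ≅ R_n = k[x_σ]/J_n :
  -- well defined and injective, and surjective (it is a ring
  -- homomorphism by construction).
  InducesIso : Set _
  InducesIso =
    ((f g : PV.Pol) → (f PV.≡[mod Igen ] g) ⇔ (ι f PP.≡[mod Jgen ] ι g)) ×
    ((h : PP.Pol) → Σ PV.Pol λ f → ι f PP.≡[mod Jgen ] h)

module Submission where

-- Sending a partition to its block avoiding 1 is a bijection P_n ≅ V_n with inverse
-- S ↦ S/∁S, so ι is an isomorphism of polynomial rings and it only remains to match
-- the two ideals.  The four cells S∩T, S∩∁T, ∁S∩T, ∁S∩∁T of two partitions are
-- pairwise disjoint, so the nonempty ones are distinct: a(σ,τ) = 4 says exactly that
-- all four are nonempty.  For vertices S, T the cell ∁S∩∁T contains 1, so the three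
-- others are nonempty iff S and T are neither nested nor disjoint.  Thus the generators
-- x_σ x_τ of J_n are the monomials of the two-element non-faces of Δ_n, and every
-- non-face contains such a pair (Δ_n is a flag complex), so its monomial is a multiple
-- of one of them.

open import Defs
open import Level using (Level)
open import Data.Nat using (ℕ; zero; suc; _≤_; _<_; _∸_)
open import Data.Nat.Properties using (∸-monoʳ-≤; <⇒≢; ≤-<-trans; module ≤-Reasoning)
open import Data.Bool using (true; false)
open import Data.Vec using (_∷_; [])
open import Data.Fin using (zero)
open import Data.Fin.Subset using (Subset; ∁; _∩_; _⊆_; ∣_∣; ⊥; _∉_) renaming (_∈_ to _∈ₛ_)
open import Data.Fin.Subset.Properties
  using (∩-comm; ∩-assoc; ∩-idem; ∩-inverseʳ; ∩-zeroˡ; ∪-∩-booleanAlgebra; ∣∁p∣≡n∸∣p∣;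
         Empty-unique; ∉⊥; x∈p∩q⁺; x∈p∩q⁻; x∈∁p⇒x∉p; x∉p⇒x∈∁p; _∈?_; _⊆?_)
import Algebra.Lattice.Properties.BooleanAlgebra as BooleanAlgebraProperties
open import Data.List using (List; []; _∷_; length; filter; deduplicate; map)
open import Data.List.Properties using (filter-all; filter-notAll; length-deduplicate)
open import Data.List.Relation.Unary.All using (All; []; _∷_; all?; lookup)
open import Data.List.Relation.Unary.All.Properties using (¬All⇒Any¬)
open import Data.List.Relation.Unary.Any using (here; there)
open import Data.List.Relation.Unary.AllPairs using (AllPairs; []; _∷_)
open import Data.List.Membership.Propositional using (_∈_; find)
open import Data.List.Membership.Propositional.Properties using (∈-map⁺)
open import Data.Product using (Σ; ∃₂; _×_; _,_; proj₁)
open import Data.Sum using (_⊎_; inj₁; inj₂)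
open import Function using (id; _∘_; _⇔_; mk⇔)
open import Relation.Binary using (Setoid; Rel)
import Relation.Binary.Definitions as B
open import Relation.Binary.PropositionalEquality
  using (_≡_; _≢_; refl; sym; trans; cong; cong₂; subst; module ≡-Reasoning)
open import Relation.Nullary using (¬_; ¬?; yes; no; contradiction)
open import Relation.Nullary.Decidable using (_⊎-dec_)
open import Relation.Unary using (Decidable)
open import Algebra.Bundles using (CommutativeRing)

module PolyProperties {c ℓ x e : Level} (K : CommutativeRing c ℓ) (X : Setoid x e) where
  open Poly K X
  open CommutativeRing K using (0#; 1#)

  ~-setoid : Setoid _ _
  ~-setoid = record
    { Carrier = Pol ; _≈_ = _~_
    ; isEquivalence = record { refl = ~refl ; sym = ~sym ; trans = ~trans } }

  open import Relation.Binary.Reasoning.Setoid ~-setoid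

  ~⇒≡[mod] : ∀ {g} {G : Pol → Set g} {p q} → p ~ q → p ≡[mod G ] q
  ~⇒≡[mod] {p = p} {q} p~q = resp (~sym p-q~0) zero
    where
    p-q~0 : p ⊕ (⊝ q) ~ con 0#
    p-q~0 = begin
      p ⊕ (⊝ q)  ≈⟨ ⊕-cong p~q ~refl ⟩
      q ⊕ (⊝ q)  ≈⟨ ⊕-comm q (⊝ q) ⟩
      (⊝ q) ⊕ q  ≈⟨ ⊝-invˡ q ⟩
      con 0#     ∎

  prodVars-pair : ∀ u v → prodVars (u ∷ v ∷ []) ~ var u ⊗ var v
  prodVars-pair u v = ⊗-cong ~refl (~trans (⊗-comm (var v) (con 1#)) (⊗-idˡ (var v)))

  prodVars-factor : ∀ {v N} → v ∈ N → Σ Pol λ r → prodVars N ~ var v ⊗ r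
  prodVars-factor {N = _ ∷ N} (here refl) = prodVars N , ~refl
  prodVars-factor {v} {u ∷ N} (there v∈N) with prodVars-factor v∈N
  ... | r , N~vr = var u ⊗ r , (begin
    var u ⊗ prodVars N     ≈⟨ ⊗-cong ~refl N~vr ⟩
    var u ⊗ (var v ⊗ r)    ≈⟨ ~sym (⊗-assoc (var u) (var v) r) ⟩
    (var u ⊗ var v) ⊗ r    ≈⟨ ⊗-cong (⊗-comm (var u) (var v)) ~refl ⟩
    (var v ⊗ var u) ⊗ r    ≈⟨ ⊗-assoc (var v) (var u) r ⟩
    var v ⊗ (var u ⊗ r)    ∎)

  module _ {g} {G : Pol → Set g} where

    var⊗prodVars-∈-ideal : ∀ {u v N} → v ∈ N →
                           InIdeal G (var u ⊗ var v) → InIdeal G (var u ⊗ prodVars N)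
    var⊗prodVars-∈-ideal {u} {v} {N} v∈N uv∈G with prodVars-factor v∈N
    ... | r , N~vr = resp r·uv~u·N (mul r uv∈G)
      where
      r·uv~u·N : r ⊗ (var u ⊗ var v) ~ var u ⊗ prodVars N
      r·uv~u·N = begin
        r ⊗ (var u ⊗ var v)  ≈⟨ ⊗-comm r (var u ⊗ var v) ⟩
        (var u ⊗ var v) ⊗ r  ≈⟨ ⊗-assoc (var u) (var v) r ⟩
        var u ⊗ (var v ⊗ r)  ≈⟨ ⊗-cong ~refl (~sym N~vr) ⟩
        var u ⊗ prodVars N   ∎

    prodVars-∈-ideal : ∀ {u v N} → u ∈ N → v ∈ N → u ≢ v →
                       InIdeal G (var u ⊗ var v) → InIdeal G (prodVars N)
    prodVars-∈-ideal (here refl) (here refl) u≢v _ = contradiction refl u≢v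
    prodVars-∈-ideal (here refl) (there v∈N) _ uv∈G = var⊗prodVars-∈-ideal v∈N uv∈G
    prodVars-∈-ideal {u} {v} (there u∈N) (here refl) _ uv∈G =
      var⊗prodVars-∈-ideal u∈N (resp (⊗-comm (var u) (var v)) uv∈G)
    prodVars-∈-ideal {N = w ∷ _} (there u∈N) (there v∈N) u≢v uv∈G =
      mul (var w) (prodVars-∈-ideal u∈N v∈N u≢v uv∈G)

module _ {c ℓ x e y f : Level} (K : CommutativeRing c ℓ) {X : Setoid x e} {Y : Setoid y f} where
  private
    module PX = Poly K X
    module PY = Poly K Y
  open Setoid X using () renaming (Carrier to A; _≈_ to _≈X_)
  open Setoid Y using () renaming (Carrier to B; _≈_ to _≈Y_)

  module _ {h : A → B} (h-resp : ∀ {u v} → u ≈X v → h u ≈Y h v) where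

    subst-vars-cong : ∀ {p q} → p PX.~ q → subst-vars K X Y h p PY.~ subst-vars K X Y h q
    subst-vars-cong PX.~refl             = PY.~refl
    subst-vars-cong (PX.~sym r)          = PY.~sym (subst-vars-cong r)
    subst-vars-cong (PX.~trans r s)      = PY.~trans (subst-vars-cong r) (subst-vars-cong s)
    subst-vars-cong (PX.⊕-cong r s)      = PY.⊕-cong (subst-vars-cong r) (subst-vars-cong s)
    subst-vars-cong (PX.⊗-cong r s)      = PY.⊗-cong (subst-vars-cong r) (subst-vars-cong s)
    subst-vars-cong (PX.⊝-cong r)        = PY.⊝-cong (subst-vars-cong r)
    subst-vars-cong (PX.⊕-assoc p q r)   = PY.⊕-assoc _ _ _
    subst-vars-cong (PX.⊕-comm p q)      = PY.⊕-comm _ _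
    subst-vars-cong (PX.⊕-idˡ p)         = PY.⊕-idˡ _
    subst-vars-cong (PX.⊝-invˡ p)        = PY.⊝-invˡ _
    subst-vars-cong (PX.⊗-assoc p q r)   = PY.⊗-assoc _ _ _
    subst-vars-cong (PX.⊗-comm p q)      = PY.⊗-comm _ _
    subst-vars-cong (PX.⊗-idˡ p)         = PY.⊗-idˡ _
    subst-vars-cong (PX.distribʳ p q r)  = PY.distribʳ _ _ _
    subst-vars-cong (PX.con-cong a≈b)    = PY.con-cong a≈b
    subst-vars-cong (PX.con-+ a b)       = PY.con-+ a b
    subst-vars-cong (PX.con-* a b)       = PY.con-* a b
    subst-vars-cong (PX.var-cong u≈v)    = PY.var-cong (h-resp u≈v)

    subst-vars-ideal : ∀ {g g'} {G : PX.Pol → Set g} {G' : PY.Pol → Set g'} →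
                       (∀ {p} → G p → PY.InIdeal G' (subst-vars K X Y h p)) →
                       ∀ {p} → PX.InIdeal G p → PY.InIdeal G' (subst-vars K X Y h p)
    subst-vars-ideal gens (PX.gen p∈G)  = gens p∈G
    subst-vars-ideal gens PX.zero       = PY.zero
    subst-vars-ideal gens (PX.add i j)  = PY.add (subst-vars-ideal gens i) (subst-vars-ideal gens j)
    subst-vars-ideal gens (PX.mul r i)  = PY.mul (subst-vars K X Y h r) (subst-vars-ideal gens i)
    subst-vars-ideal gens (PX.resp r i) = PY.resp (subst-vars-cong r) (subst-vars-ideal gens i)

  subst-vars-inverse : ∀ {h : A → B} {k : B → A} → (∀ v → k (h v) ≈X v) →
                       ∀ p → subst-vars K Y X k (subst-vars K X Y h p) PX.~ p
  subst-vars-inverse kh (PX.con a) = PX.~refl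
  subst-vars-inverse kh (PX.var v) = PX.var-cong (kh v)
  subst-vars-inverse kh (p PX.⊕ q) = PX.⊕-cong (subst-vars-inverse kh p) (subst-vars-inverse kh q)
  subst-vars-inverse kh (p PX.⊗ q) = PX.⊗-cong (subst-vars-inverse kh p) (subst-vars-inverse kh q)
  subst-vars-inverse kh (PX.⊝ p)   = PX.⊝-cong (subst-vars-inverse kh p)

  subst-vars-prodVars : ∀ (h : A → B) N → subst-vars K X Y h (PX.prodVars N) ≡ PY.prodVars (map h N)
  subst-vars-prodVars h []      = refl
  subst-vars-prodVars h (v ∷ N) = cong (PY.var (h v) PY.⊗_) (subst-vars-prodVars h N)

module _ {c ℓ x e y f g g' : Level} (K : CommutativeRing c ℓ) {X : Setoid x e} {Y : Setoid y f}
         {G : Poly.Pol K X → Set g} {G' : Poly.Pol K Y → Set g'} where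
  private
    module PX = Poly K X
    module PY = Poly K Y
  open Setoid X using () renaming (Carrier to A; _≈_ to _≈X_)
  open Setoid Y using () renaming (Carrier to B; _≈_ to _≈Y_)

  subst-vars-inducesIso :
    {h : A → B} {k : B → A} →
    (∀ {u v} → u ≈X v → h u ≈Y h v) → (∀ {u v} → u ≈Y v → k u ≈X k v) →
    (∀ v → k (h v) ≈X v) → (∀ w → h (k w) ≈Y w) →
    (∀ {p} → G p → PY.InIdeal G' (subst-vars K X Y h p)) →
    (∀ {q} → G' q → PX.InIdeal G (subst-vars K Y X k q)) →
    ((p p' : PX.Pol) →
       (p PX.≡[mod G ] p') ⇔ (subst-vars K X Y h p PY.≡[mod G' ] subst-vars K X Y h p')) ×
    ((q : PY.Pol) → Σ PX.Pol λ p → subst-vars K X Y h p PY.≡[mod G' ] q)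
  subst-vars-inducesIso {h} {k} h-resp k-resp kh hk h-gens k-gens =
    (λ p p' → mk⇔ (subst-vars-ideal K h-resp h-gens) (reflect p p')) ,
    (λ q → subst-vars K Y X k q , PolyProperties.~⇒≡[mod] K Y (subst-vars-inverse K hk q))
    where
    reflect : ∀ p p' → subst-vars K X Y h p PY.≡[mod G' ] subst-vars K X Y h p' → p PX.≡[mod G ] p'
    reflect p p' hp≡hp' =
      PX.resp (PX.⊕-cong (subst-vars-inverse K kh p) (PX.⊝-cong (subst-vars-inverse K kh p')))
              (subst-vars-ideal K k-resp k-gens hp≡hp')

module _ {a r} {A : Set a} {R : Rel A r} (R? : B.Decidable R) where

  deduplicate-id : ∀ {xs} → AllPairs (λ x y → ¬ R x y) xs → deduplicate R? xs ≡ xs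
  deduplicate-id []                          = refl
  deduplicate-id {x ∷ xs} (x≁xs ∷ xs-apart) = begin
    x ∷ filter (¬? ∘ R? x) (deduplicate R? xs)
      ≡⟨ cong (λ ys → x ∷ filter (¬? ∘ R? x) ys) (deduplicate-id xs-apart) ⟩
    x ∷ filter (¬? ∘ R? x) xs
      ≡⟨ cong (x ∷_) (filter-all (¬? ∘ R? x) x≁xs) ⟩
    x ∷ xs ∎
    where open ≡-Reasoning

  ∃-unrelated-pair : ∀ xs → ¬ (∀ {x y} → x ∈ xs → y ∈ xs → R x y) →
                     ∃₂ λ x y → x ∈ xs × y ∈ xs × ¬ R x y
  ∃-unrelated-pair xs ¬related with all? (λ x → all? (R? x) xs) xs
  ... | yes related =
    contradiction (λ {x} {y} x∈xs y∈xs → lookup (lookup related x∈xs) y∈xs) ¬related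
  ... | no ¬related′ with find (¬All⇒Any¬ (λ x → all? (R? x) xs) xs ¬related′)
  ... | x , x∈xs , ¬relatedˣ with find (¬All⇒Any¬ (R? x) xs ¬relatedˣ)
  ... | y , y∈xs , ¬Rxy = x , y , x∈xs , y∈xs , ¬Rxy

∁-involutive : ∀ {n} (S : Subset n) → ∁ (∁ S) ≡ S
∁-involutive {n} = BooleanAlgebraProperties.¬-involutive (∪-∩-booleanAlgebra n)

∩-∁ˡ-disjoint : ∀ {n} (S X Y : Subset n) → (S ∩ X) ∩ (∁ S ∩ Y) ≡ ⊥
∩-∁ˡ-disjoint S X Y = begin
  (S ∩ X) ∩ (∁ S ∩ Y)  ≡⟨ ∩-assoc S X (∁ S ∩ Y) ⟩
  S ∩ (X ∩ (∁ S ∩ Y))  ≡⟨ cong (S ∩_) (∩-comm X (∁ S ∩ Y)) ⟩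
  S ∩ ((∁ S ∩ Y) ∩ X)  ≡⟨ cong (S ∩_) (∩-assoc (∁ S) Y X) ⟩
  S ∩ (∁ S ∩ (Y ∩ X))  ≡⟨ ∩-assoc S (∁ S) (Y ∩ X) ⟨
  (S ∩ ∁ S) ∩ (Y ∩ X)  ≡⟨ cong (_∩ (Y ∩ X)) (∩-inverseʳ S) ⟩
  ⊥ ∩ (Y ∩ X)          ≡⟨ ∩-zeroˡ (Y ∩ X) ⟩
  ⊥                    ∎
  where open ≡-Reasoning

∩-∁ʳ-disjoint : ∀ {n} (X Y S : Subset n) → (X ∩ S) ∩ (Y ∩ ∁ S) ≡ ⊥
∩-∁ʳ-disjoint X Y S =
  trans (cong₂ _∩_ (∩-comm X S) (∩-comm Y (∁ S))) (∩-∁ˡ-disjoint S X Y)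

p⊆q⇒p∩∁q≡⊥ : ∀ {n} {S T : Subset n} → S ⊆ T → S ∩ ∁ T ≡ ⊥
p⊆q⇒p∩∁q≡⊥ {S = S} {T} S⊆T = Empty-unique λ where
  (x , x∈S∩∁T) → let x∈S , x∈∁T = x∈p∩q⁻ S (∁ T) x∈S∩∁T in x∈∁p⇒x∉p x∈∁T (S⊆T x∈S)

p∩∁q≡⊥⇒p⊆q : ∀ {n} {S T : Subset n} → S ∩ ∁ T ≡ ⊥ → S ⊆ T
p∩∁q≡⊥⇒p⊆q {T = T} S∩∁T≡⊥ {x} x∈S with x ∈? T
... | yes x∈T = x∈T
... | no x∉T  = contradiction (subst (x ∈ₛ_) S∩∁T≡⊥ (x∈p∩q⁺ (x∈S , x∉p⇒x∈∁p x∉T))) ∉⊥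

p∩q≡⊥⇒p≢q : ∀ {n} {S T : Subset n} → S ≢ ⊥ → S ∩ T ≡ ⊥ → S ≢ T
p∩q≡⊥⇒p≢q {S = S} S≢⊥ S∩S≡⊥ refl = S≢⊥ (trans (sym (∩-idem S)) S∩S≡⊥)

cells : ∀ {n} → Subset n → Subset n → List (Subset n)
cells S T = (S ∩ T) ∷ (S ∩ ∁ T) ∷ (∁ S ∩ T) ∷ (∁ S ∩ ∁ T) ∷ []

Crosses : ∀ {n} → Subset n → Subset n → Set
Crosses S T = All (_≢ ⊥) (cells S T)

Crosses-∁ˡ : ∀ {n} {S T : Subset n} → Crosses S T → Crosses (∁ S) T
Crosses-∁ˡ {S = S} (c₁ ∷ c₂ ∷ c₃ ∷ c₄ ∷ []) rewrite ∁-involutive S = c₃ ∷ c₄ ∷ c₁ ∷ c₂ ∷ []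

Crosses-∁ʳ : ∀ {n} {S T : Subset n} → Crosses S T → Crosses S (∁ T)
Crosses-∁ʳ {T = T} (c₁ ∷ c₂ ∷ c₃ ∷ c₄ ∷ []) rewrite ∁-involutive T = c₂ ∷ c₁ ∷ c₄ ∷ c₃ ∷ []

Crosses-respˡ : ∀ {n} {S S′ T : Subset n} → (S′ ≡ S) ⊎ (S′ ≡ ∁ S) → Crosses S T → Crosses S′ T
Crosses-respˡ (inj₁ refl) = id
Crosses-respˡ (inj₂ refl) = Crosses-∁ˡ

Crosses-respʳ : ∀ {n} {S T T′ : Subset n} → (T′ ≡ T) ⊎ (T′ ≡ ∁ T) → Crosses S T → Crosses S T′
Crosses-respʳ (inj₁ refl) = id
Crosses-respʳ (inj₂ refl) = Crosses-∁ʳ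

Crosses⇒≢ : ∀ {n} {S T : Subset n} → Crosses S T → S ≢ T
Crosses⇒≢ (_ ∷ S∩∁S≢⊥ ∷ _) refl = S∩∁S≢⊥ (∩-inverseʳ _)

cells-distinct : ∀ {n} {S T : Subset n} → Crosses S T → AllPairs _≢_ (cells S T)
cells-distinct {S = S} {T} (c₁ ∷ c₂ ∷ c₃ ∷ _ ∷ []) =
  (p∩q≡⊥⇒p≢q c₁ (∩-∁ʳ-disjoint S S T) ∷ p∩q≡⊥⇒p≢q c₁ (∩-∁ˡ-disjoint S T T) ∷
   p∩q≡⊥⇒p≢q c₁ (∩-∁ˡ-disjoint S T (∁ T)) ∷ []) ∷
  (p∩q≡⊥⇒p≢q c₂ (∩-∁ˡ-disjoint S (∁ T) T) ∷
   p∩q≡⊥⇒p≢q c₂ (∩-∁ˡ-disjoint S (∁ T) (∁ T)) ∷ []) ∷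
  (p∩q≡⊥⇒p≢q c₃ (∩-∁ʳ-disjoint (∁ S) (∁ S) T) ∷ []) ∷
  [] ∷ []

nonempty? : ∀ {n} → Decidable {A = Subset n} (_≢ ⊥)
nonempty? X = ¬? (X ≟S ⊥)

module _ {n : ℕ} (σ τ : PRep n) where
  private
    S T : Subset n
    S = block₁ σ
    T = block₁ τ

  Crosses⇒a≡4 : Crosses S T → a σ τ ≡ 4
  Crosses⇒a≡4 crosses = begin
    length (deduplicate _≟S_ (filter nonempty? (cells S T)))
      ≡⟨ cong (length ∘ deduplicate _≟S_) (filter-all nonempty? crosses) ⟩
    length (deduplicate _≟S_ (cells S T))
      ≡⟨ cong length (deduplicate-id _≟S_ (cells-distinct crosses)) ⟩
    4 ∎
    where open ≡-Reasoning

  a≡4⇒Crosses : a σ τ ≡ 4 → Crosses S T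
  a≡4⇒Crosses a≡4 with all? nonempty? (cells S T)
  ... | yes crosses = crosses
  ... | no ¬crosses = contradiction a≡4 (<⇒≢ a<4)
    where
    a<4 : a σ τ < 4
    a<4 = ≤-<-trans (length-deduplicate _≟S_ (filter nonempty? (cells S T)))
                    (filter-notAll nonempty? (cells S T) (¬All⇒Any¬ nonempty? (cells S T) ¬crosses))

Compatible : ∀ {n} → Subset n → Subset n → Set
Compatible S T = (S ⊆ T) ⊎ (T ⊆ S) ⊎ (S ∩ T ≡ ⊥)

compatible? : ∀ {n} → B.Decidable {A = Subset n} Compatible
compatible? S T = (S ⊆? T) ⊎-dec (T ⊆? S) ⊎-dec ((S ∩ T) ≟S ⊥)

Crosses⇒¬Compatible : ∀ {n} {S T : Subset n} → Crosses S T → ¬ Compatible S T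
Crosses⇒¬Compatible (_ ∷ S∩∁T≢⊥ ∷ _) (inj₁ S⊆T) = S∩∁T≢⊥ (p⊆q⇒p∩∁q≡⊥ S⊆T)
Crosses⇒¬Compatible {S = S} {T} (_ ∷ _ ∷ ∁S∩T≢⊥ ∷ _) (inj₂ (inj₁ T⊆S)) =
  ∁S∩T≢⊥ (trans (∩-comm (∁ S) T) (p⊆q⇒p∩∁q≡⊥ T⊆S))
Crosses⇒¬Compatible (S∩T≢⊥ ∷ _) (inj₂ (inj₂ S∩T≡⊥)) = S∩T≢⊥ S∩T≡⊥

has1≡false⇒1∉ : ∀ {n} {S : Subset (suc n)} → has1 S ≡ false → zero ∉ S
has1≡false⇒1∉ {S = false ∷ _} _ ()
has1≡false⇒1∉ {S = true ∷ _}  ()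

∁∩∁-vertices≢⊥ : ∀ {n} (u v : VRep n) → ∁ (proj₁ u) ∩ ∁ (proj₁ v) ≢ ⊥
∁∩∁-vertices≢⊥ {zero}  ([] , _ , () , _) _
∁∩∁-vertices≢⊥ {suc n} (S , 1∉S , _) (T , 1∉T , _) ∁S∩∁T≡⊥ =
  ∉⊥ (subst (zero ∈ₛ_) ∁S∩∁T≡⊥
    (x∈p∩q⁺ (x∉p⇒x∈∁p (has1≡false⇒1∉ 1∉S) , x∉p⇒x∈∁p (has1≡false⇒1∉ 1∉T))))

¬Compatible⇒Crosses : ∀ {n} (u v : VRep n) →
                       ¬ Compatible (proj₁ u) (proj₁ v) → Crosses (proj₁ u) (proj₁ v)
¬Compatible⇒Crosses u@(S , _) v@(T , _) ¬compatible =
  (¬compatible ∘ inj₂ ∘ inj₂) ∷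
  (¬compatible ∘ inj₁ ∘ p∩∁q≡⊥⇒p⊆q) ∷
  (¬compatible ∘ inj₂ ∘ inj₁ ∘ p∩∁q≡⊥⇒p⊆q ∘ trans (∩-comm T (∁ S))) ∷
  ∁∩∁-vertices≢⊥ u v ∷ []

blockWithout1 : ∀ {n} → Subset n → Subset n
blockWithout1 []          = []
blockWithout1 (false ∷ S) = false ∷ S
blockWithout1 (true ∷ S)  = ∁ (true ∷ S)

blockWithout1-cases : ∀ {n} (S : Subset n) → (blockWithout1 S ≡ S) ⊎ (blockWithout1 S ≡ ∁ S)
blockWithout1-cases []          = inj₁ refl
blockWithout1-cases (false ∷ S) = inj₁ refl
blockWithout1-cases (true ∷ S)  = inj₂ refl

has1-blockWithout1 : ∀ {n} (S : Subset n) → has1 (blockWithout1 S) ≡ false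
has1-blockWithout1 []          = refl
has1-blockWithout1 (false ∷ S) = refl
has1-blockWithout1 (true ∷ S)  = refl

blockWithout1-id : ∀ {n} {S : Subset n} → has1 S ≡ false → blockWithout1 S ≡ S
blockWithout1-id {S = []}        _ = refl
blockWithout1-id {S = false ∷ S} _ = refl

blockWithout1-∁ : ∀ {n} (S : Subset n) → blockWithout1 (∁ S) ≡ blockWithout1 S
blockWithout1-∁ []          = refl
blockWithout1-∁ (false ∷ S) = cong (false ∷_) (∁-involutive S)
blockWithout1-∁ (true ∷ S)  = refl

Crosses-blockWithout1 : ∀ {n} {S T : Subset n} →
                        Crosses S T → Crosses (blockWithout1 S) (blockWithout1 T)
Crosses-blockWithout1 {S = S} {T} =
  Crosses-respʳ (blockWithout1-cases T) ∘ Crosses-respˡ (blockWithout1-cases S)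

∣p∣≤n∸2 : ∀ {n} (S : Subset n) → 2 ≤ ∣ ∁ S ∣ → ∣ S ∣ ≤ n ∸ 2
∣p∣≤n∸2 {n} S 2≤∣∁S∣ = begin
  ∣ S ∣        ≡⟨ cong ∣_∣ (∁-involutive S) ⟨
  ∣ ∁ (∁ S) ∣  ≡⟨ ∣∁p∣≡n∸∣p∣ (∁ S) ⟩
  n ∸ ∣ ∁ S ∣  ≤⟨ ∸-monoʳ-≤ n 2≤∣∁S∣ ⟩
  n ∸ 2        ∎
  where open ≤-Reasoning

partition↦vertex : ∀ {n} → PRep n → VRep n
partition↦vertex {n} (S , 2≤∣S∣ , 2≤∣∁S∣) =
  blockWithout1 S , has1-blockWithout1 S , bounds (blockWithout1-cases S)
  where
  bounds : ∀ {S′} → (S′ ≡ S) ⊎ (S′ ≡ ∁ S) → (2 ≤ ∣ S′ ∣) × (∣ S′ ∣ ≤ n ∸ 2)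
  bounds (inj₁ refl) = 2≤∣S∣ , ∣p∣≤n∸2 S 2≤∣∁S∣
  bounds (inj₂ refl) =
    2≤∣∁S∣ , ∣p∣≤n∸2 (∁ S) (subst (2 ≤_) (cong ∣_∣ (sym (∁-involutive S))) 2≤∣S∣)

partition↦vertex-resp : ∀ {n} {σ τ : PRep n} →
                        σ ≈P τ → proj₁ (partition↦vertex σ) ≡ proj₁ (partition↦vertex τ)
partition↦vertex-resp (inj₁ S≡T) = cong blockWithout1 S≡T
partition↦vertex-resp {τ = τ} (inj₂ S≡∁T) =
  trans (cong blockWithout1 S≡∁T) (blockWithout1-∁ (block₁ τ))

partition↦vertex∘vertex↦partition : ∀ {n} (v : VRep n) →
                                    proj₁ (partition↦vertex (vertex↦partition v)) ≡ proj₁ v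
partition↦vertex∘vertex↦partition (_ , 1∉S , _) = blockWithout1-id 1∉S

vertex↦partition∘partition↦vertex : ∀ {n} (σ : PRep n) →
                                    vertex↦partition (partition↦vertex σ) ≈P σ
vertex↦partition∘partition↦vertex (S , _) = blockWithout1-cases S

module _ {c ℓ : Level} (K : CommutativeRing c ℓ) (n : ℕ) where
  open Rings K n
  open PolyProperties K (V n) using (prodVars-pair)
  open PolyProperties K (P n) using (prodVars-∈-ideal)

  partition↦vertex-maps-Jgen : ∀ {p} → Jgen p →
                               PV.InIdeal Igen (subst-vars K (P n) (V n) partition↦vertex p)
  partition↦vertex-maps-Jgen (σ , τ , a≡4 , refl) =
    PV.resp (prodVars-pair u v) (PV.gen (u ∷ v ∷ [] , distinct , nonface , refl))
    where
    u v : VRep n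
    u = partition↦vertex σ
    v = partition↦vertex τ
    crosses : Crosses (proj₁ u) (proj₁ v)
    crosses = Crosses-blockWithout1 (a≡4⇒Crosses σ τ a≡4)
    distinct : Distinct (u ∷ v ∷ [])
    distinct = (Crosses⇒≢ crosses ∷ []) ∷ [] ∷ []
    nonface : ¬ IsFace (u ∷ v ∷ [])
    nonface face = Crosses⇒¬Compatible crosses (face (here refl) (there (here refl)))

  vertex↦partition-maps-Igen : ∀ {p} → Igen p → PP.InIdeal Jgen (ι p)
  vertex↦partition-maps-Igen (N , _ , nonface , refl)
    with ∃-unrelated-pair (λ u v → compatible? (proj₁ u) (proj₁ v)) N nonface
  ... | u , v , u∈N , v∈N , ¬compatible =
    subst (PP.InIdeal Jgen) (sym (subst-vars-prodVars K vertex↦partition N))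
      (prodVars-∈-ideal (∈-map⁺ vertex↦partition u∈N) (∈-map⁺ vertex↦partition v∈N)
        (Crosses⇒≢ crosses ∘ cong proj₁) (PP.gen (σ , τ , Crosses⇒a≡4 σ τ crosses , refl)))
    where
    σ τ : PRep n
    σ = vertex↦partition u
    τ = vertex↦partition v
    crosses : Crosses (proj₁ u) (proj₁ v)
    crosses = ¬Compatible⇒Crosses u v ¬compatible

proposition2p1 : {c ℓ : Level} (K : CommutativeRing c ℓ) → IsField K → CharZero K →
    (n : ℕ) → 3 ≤ n → Rings.InducesIso K n
proposition2p1 K _ _ n _ =
  subst-vars-inducesIso K inj₁ (λ {σ} {τ} → partition↦vertex-resp {σ = σ} {τ})
    partition↦vertex∘vertex↦partition vertex↦partition∘partition↦vertex
    (vertex↦partition-maps-Igen K n) (partition↦vertex-maps-Jgen K n)
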